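{- For every finite poset $P$, one has \[ \mathsf{Z}_{J(P),\operatorname{rk}}(1+qx) = \mathsf{L}_{\overline{P}}(x), \] where $J(P)$ is the distributive lattice of lower ideals of $P$ ordered by inclusion, with rank function $\operatorname{rk}(I)=\#I$, and $\overline{P}$ is the dual poset of $P$.
   Context: Let $q$ be an indeterminate and $[n]_q=(q^n-1)/(q-1)$ for $n\in\mathbb{Z}$. For a finite poset $Q$ with a height function $h:Q\to\mathbb{N}$ (i.e. $h(x)<h(y)$ whenever $y$ covers $x$), the $q$-Zeta polynomial $\mathsf{Z}_{Q,h}(x)\in\mathbb{Q}(q)[x]$ is the unique polynomial such that for every integer $n\ge 2$, $\mathsf{Z}_{Q,h}([n]_q)=\sum_{e_1\le\cdots\le e_{n-1}} q^{h(e_1)+\cdots+h(e_{n-1})}$, summed over all weakly increasing sequences of $n-1$ elements of $Q$. The order polytope $Q_R$ of a finite poset $R$ is the polytope in $\mathbb{R}^R$ defined by $0\le z_p\le 1$ for all $p\in R$ and $z_p\le z_{p'}$ whenever $p\le p'$ in $R$. The $q$-order polynomial $\mathsf{L}_R(x)\in\mathbb{Q}(q)[x]$ is the unique polynomial such that for every integer $n\ge 0$, $\mathsf{L}_R([n]_q)=\sum_{z} q^{\sum_{p\in R} z_p}$, the sum running over all integer points $z\in\mathbb{Z}^R$ of the dilate $nQ_R$. -}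

module Defs where

open import Data.Bool using (Bool; true; false; T; _∧_; _∨_; not)
open import Data.Nat as ℕ using (ℕ; zero; suc)
open import Data.Integer as ℤ using (ℤ; +_; 0ℤ; 1ℤ)
open import Data.List using (List; []; _∷_; map; foldr; concatMap; replicate; _++_; upTo)
open import Data.Nat.ListAction using (sum)
open import Data.List.Relation.Unary.All using (All)
open import Data.Vec using (Vec; []; _∷_; lookup)
open import Data.Fin using (Fin)
open import Data.Fin.Subset using (Subset; ∣_∣)
open import Data.List using (allFin)
open import Relation.Binary.PropositionalEquality using (_≡_)
open import Relation.Binary.Structures using (IsPartialOrder)
open import Relation.Nullary using (¬_)

filterᵇ : {A : Set} → (A → Bool) → List A → List A
filterᵇ p [] = []
filterᵇ p (x ∷ xs) with p x
... | true = x ∷ filterᵇ p xs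
... | false = filterᵇ p xs

all : {A : Set} → (A → Bool) → List A → Bool
all p [] = true
all p (x ∷ xs) = p x ∧ all p xs

-- ℤ[q] : polynomials in q with integer coefficients (index i = coeff of q^i)

Zq : Set
Zq = List ℤ

addZ : Zq → Zq → Zq
addZ [] r = r
addZ (a ∷ p) [] = a ∷ p
addZ (a ∷ p) (b ∷ r) = (a ℤ.+ b) ∷ addZ p r

negZ : Zq → Zq
negZ = map (λ a → ℤ.- a)

scaleZ : ℤ → Zq → Zq
scaleZ a = map (a ℤ.*_)

mulZ : Zq → Zq → Zq
mulZ [] r = []
mulZ (a ∷ p) r = addZ (scaleZ a r) (0ℤ ∷ mulZ p r)

IsZeroZ : Zq → Set
IsZeroZ p = All (_≡ 0ℤ) p

-- equality in ℤ[q] (up to trailing zeros)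
_≈Z_ : Zq → Zq → Set
p ≈Z r = IsZeroZ (addZ p (negZ r))

qpow : ℕ → Zq
qpow k = replicate k 0ℤ ++ (1ℤ ∷ [])

qint : ℕ → Zq
qint n = replicate n 1ℤ

sumZ : List Zq → Zq
sumZ = foldr addZ []

PolyX : Set
PolyX = List Zq

addX : PolyX → PolyX → PolyX
addX [] r = r
addX (a ∷ p) [] = a ∷ p
addX (a ∷ p) (b ∷ r) = addZ a b ∷ addX p r

negX : PolyX → PolyX
negX = map negZ

mulX : PolyX → PolyX → PolyX
mulX [] r = []
mulX (c ∷ p) r = addX (map (mulZ c) r) ([] ∷ mulX p r)

evalX : PolyX → Zq → Zq
evalX [] v = []
evalX (c ∷ p) v = addZ c (mulZ v (evalX p v))

compX : PolyX → PolyX → PolyX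
compX [] r = []
compX (c ∷ p) r = addX (c ∷ []) (mulX r (compX p r))

_≈X_ : PolyX → PolyX → Set
p ≈X r = All IsZeroZ (addX p (negX r))

onePlusQx : PolyX
onePlusQx = (1ℤ ∷ []) ∷ qpow 1 ∷ []

-- ℚ(q)[x] : a polynomial with coefficients in ℚ(q) = Frac(ℤ[q]) is
-- represented as  num(x) / den  with num ∈ ℤ[q][x] and 0 ≠ den ∈ ℤ[q].

record QPoly : Set where
  field
    num : PolyX
    den : Zq
    den≢0 : ¬ IsZeroZ den
open QPoly public

EvalsTo : QPoly → ℕ → Zq → Set
EvalsTo F n S = evalX (num F) (qint n) ≈Z mulZ (den F) S

_∘1+qx≈_ : QPoly → QPoly → Set
F ∘1+qx≈ G = map (mulZ (den G)) (compX (num F) onePlusQx) ≈X map (mulZ (den F)) (num G)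

record FinPoset : Set₁ where
  field
    size : ℕ
    leq  : Fin size → Fin size → Bool
    isPartialOrder : IsPartialOrder _≡_ (λ a b → T (leq a b))
open FinPoset public

dual : FinPoset → FinPoset
dual P = record
  { size = size P
  ; leq = λ a b → leq P b a
  ; isPartialOrder = record
      { isPreorder = record
          { isEquivalence = IsPreorder.isEquivalence (IsPartialOrder.isPreorder po)
          ; reflexive = λ { Relation.Binary.PropositionalEquality.refl →
                               IsPreorder.reflexive (IsPartialOrder.isPreorder po)
                                 Relation.Binary.PropositionalEquality.refl }
          ; trans = λ p r → IsPreorder.trans (IsPartialOrder.isPreorder po) r p
          }
      ; antisym = λ p r → IsPartialOrder.antisym po r p
      }
  }
  where
  po = isPartialOrder P
  open import Relation.Binary.Structures using (IsPreorder)

allSeqs : {A : Set} → List A → ℕ → List (List A)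
allSeqs es zero = [] ∷ []
allSeqs es (suc m) = concatMap (λ e → map (e ∷_) (allSeqs es m)) es

weaklyIncr : {A : Set} → (A → A → Bool) → List A → Bool
weaklyIncr le [] = true
weaklyIncr le (a ∷ []) = true
weaklyIncr le (a ∷ b ∷ s) = le a b ∧ weaklyIncr le (b ∷ s)

zetaSum : {A : Set} → List A → (A → A → Bool) → (A → ℕ) → ℕ → Zq
zetaSum es le h m =
  sumZ (map (λ s → qpow (sum (map h s))) (filterᵇ (λ s → weaklyIncr le s) (allSeqs es m)))

IsQZetaPoly : {A : Set} → List A → (A → A → Bool) → (A → ℕ) → QPoly → Set
IsQZetaPoly es le h F = ∀ n → 2 ℕ.≤ n → EvalsTo F n (zetaSum es le h (n ℕ.∸ 1))

allSubsets : ∀ n → List (Subset n)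
allSubsets zero = [] ∷ []
allSubsets (suc n) = concatMap (λ b → map (b ∷_) (allSubsets n)) (true ∷ false ∷ [])

isLowerIdeal : (P : FinPoset) → Subset (size P) → Bool
isLowerIdeal P S =
  all (λ b → all (λ a → not (leq P a b ∧ lookup S b) ∨ lookup S a) (allFin (size P)))
      (allFin (size P))

idealsJ : (P : FinPoset) → List (Subset (size P))
idealsJ P = filterᵇ (λ S → isLowerIdeal P S) (allSubsets (size P))

inclusion : ∀ {n} → Subset n → Subset n → Bool
inclusion {n} S T′ = all (λ a → not (lookup S a) ∨ lookup T′ a) (allFin n)

rk : ∀ {n} → Subset n → ℕ
rk S = ∣ S ∣

-- q-order polynomial: Σ over integer points z of n·Q_R of q^(Σ z_p)

allVecsUpTo : ℕ → ∀ k → List (Vec ℕ k)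
allVecsUpTo n zero = [] ∷ []
allVecsUpTo n (suc k) = concatMap (λ v → map (v ∷_) (allVecsUpTo n k)) (upTo (suc n))

-- z_p ≤ z_p' whenever p ≤ p' in R  (0 ≤ z_p ≤ n is built into the enumeration)
isMonotone : (R : FinPoset) → Vec ℕ (size R) → Bool
isMonotone R z =
  all (λ p → all (λ p′ → not (leq R p p′) ∨ (lookup z p ℕ.≤ᵇ lookup z p′)) (allFin (size R)))
      (allFin (size R))

vsum : ∀ {k} → Vec ℕ k → ℕ
vsum [] = 0
vsum (x ∷ v) = x ℕ.+ vsum v

orderSum : FinPoset → ℕ → Zq
orderSum R n =
  sumZ (map (λ z → qpow (vsum z)) (filterᵇ (λ z → isMonotone R z) (allVecsUpTo n (size R))))

IsQOrderPoly : FinPoset → QPoly → Set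
IsQOrderPoly R F = ∀ n → EvalsTo F n (orderSum R n)

-- At x = [m+1]_q one has 1 + q x = [m+2]_q, so the left side evaluates to the sum of
-- q^(Σ #Iᵢ) over multichains I₁ ⊆ ⋯ ⊆ I_{m+1} of lower ideals, and the right side to the
-- sum of q^(Σ z) over order-reversing maps z : P → {0, …, m+1}. Sending a multichain to
-- p ↦ #{i : p ∈ Iᵢ} is a weight-preserving bijection, inverse to z ↦ (level sets {z > j}),
-- so these sums are equal in ℤ[q]. Specialising q to integers t ≥ 1 reduces the identity
-- of polynomials to the fact that an integer polynomial with infinitely many roots is zero,
-- used in x at the distinct points [m+1]_t and then in q.

module Submission where

open import Defs

open import Algebra.Structures using (IsCommutativeMonoid)
open import Algebra.Structures.Biased using (isCommutativeMonoidˡ)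
open import Data.Bool using (Bool; true; false; T; _∧_; _∨_; not)
import Data.Bool.ListAction as ListAction
open import Data.Bool.Properties using (T-∧; T-≡)
open import Data.Empty using (⊥-elim)
open import Data.Fin using (Fin; zero; suc)
open import Data.Fin.Subset using (Subset; ∣_∣)
open import Data.Integer as ℤ using (ℤ; 0ℤ; 1ℤ; _+_; _*_; -_; _-_)
import Data.Integer.Properties as ℤ
open import Data.Integer.Tactic.RingSolver using (solve-∀)
open import Data.List as List
  using (List; []; _∷_; map; length; replicate; _++_; concatMap; cartesianProductWith; downFrom; upTo; allFin)
import Data.List.Properties as List
open import Data.List.Membership.Propositional using (_∈_)
open import Data.List.Membership.Propositional.Properties
  using (∈-cartesianProductWith⁺; ∈-cartesianProductWith⁻; ∈-filter⁺; ∈-filter⁻; ∈-upTo⁺; ∈-upTo⁻; ∈-map⁺; ∈-map⁻)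
open import Data.List.Membership.Propositional.Properties.WithK using (unique∧set⇒bag)
open import Data.List.Relation.Binary.BagAndSetEquality using (∼bag⇒↭)
open import Data.List.Relation.Binary.Permutation.Propositional using (_↭_; ↭⇒↭ₛ)
import Data.List.Relation.Binary.Permutation.Propositional.Properties as ↭
open import Data.List.Relation.Binary.Permutation.Setoid.Properties using (foldr-commMonoid)
open import Data.List.Relation.Unary.All as All using (All; []; _∷_)
import Data.List.Relation.Unary.All.Properties as All
open import Data.List.Relation.Unary.AllPairs using ([]; _∷_)
open import Data.List.Relation.Unary.Any using (here; there)
open import Data.List.Relation.Unary.Linked as Linked using (Linked; []; [-]; _∷_)
import Data.List.Relation.Unary.Linked.Properties as Linked
open import Data.List.Relation.Unary.Unique.Propositional using (Unique)
import Data.List.Relation.Unary.Unique.Propositional.Properties as Unique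
open import Data.Nat as ℕ using (ℕ; zero; suc; _∸_; _≤_; _<_; _<ᵇ_; z≤n; s≤s)
open import Data.Nat.ListAction using (sum)
import Data.Nat.Properties as ℕ
open import Data.Product using (_×_; _,_; proj₁; proj₂; ∃₂)
open import Data.Sum using (inj₁; inj₂; [_,_]′)
open import Data.Unit using (tt)
open import Data.Vec as Vec using (Vec; []; _∷_; lookup; tabulate)
import Data.Vec.Properties as Vec
open import Function using (_∘_; id; _⇔_; mk⇔; Equivalence)
open import Function.Definitions using (Injective)
open import Relation.Binary.Core using (_Preserves_⟶_)
open import Relation.Binary.Definitions using (tri<; tri≈; tri>)
open import Relation.Binary.PropositionalEquality
open import Relation.Nullary using (¬_; contradiction; T?)

open import Algebra.Properties.CommutativeSemigroup ℕ.+-commutativeSemigroup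
  using () renaming (x∙yz≈y∙xz to +-left-comm)
open import Algebra.Properties.CommutativeSemigroup ℤ.*-commutativeSemigroup
  using () renaming (x∙yz≈y∙xz to *-left-comm)
open Equivalence using (to; from)

addZ-assoc : ∀ p r u → addZ (addZ p r) u ≡ addZ p (addZ r u)
addZ-assoc []      r       u       = refl
addZ-assoc (a ∷ p) []      u       = refl
addZ-assoc (a ∷ p) (b ∷ r) []      = refl
addZ-assoc (a ∷ p) (b ∷ r) (c ∷ u) = cong₂ _∷_ (ℤ.+-assoc a b c) (addZ-assoc p r u)

addZ-comm : ∀ p r → addZ p r ≡ addZ r p
addZ-comm []      []      = refl
addZ-comm []      (b ∷ r) = refl
addZ-comm (a ∷ p) []      = refl
addZ-comm (a ∷ p) (b ∷ r) = cong₂ _∷_ (ℤ.+-comm a b) (addZ-comm p r)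

addZ-isCommutativeMonoid : IsCommutativeMonoid _≡_ addZ []
addZ-isCommutativeMonoid = isCommutativeMonoidˡ record
  { isSemigroup = record
    { isMagma = record { isEquivalence = isEquivalence ; ∙-cong = cong₂ addZ }
    ; assoc   = addZ-assoc
    }
  ; identityˡ = λ _ → refl
  ; comm      = addZ-comm
  }

sumZ-↭ : sumZ Preserves _↭_ ⟶ _≡_
sumZ-↭ p = foldr-commMonoid (setoid Zq) addZ-isCommutativeMonoid (↭⇒↭ₛ p)

filterᵇ≡List-filterᵇ : ∀ {A : Set} (p : A → Bool) xs → filterᵇ p xs ≡ List.filterᵇ p xs
filterᵇ≡List-filterᵇ p []       = refl
filterᵇ≡List-filterᵇ p (x ∷ xs) with p x
... | true  = cong (x ∷_) (filterᵇ≡List-filterᵇ p xs)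
... | false = filterᵇ≡List-filterᵇ p xs

∈-filterᵇ⁺ : ∀ {A : Set} (p : A → Bool) {x xs} → x ∈ xs → T (p x) → x ∈ filterᵇ p xs
∈-filterᵇ⁺ p {xs = xs} x∈xs px rewrite filterᵇ≡List-filterᵇ p xs = ∈-filter⁺ (T? ∘ p) x∈xs px

∈-filterᵇ⁻ : ∀ {A : Set} (p : A → Bool) {x xs} → x ∈ filterᵇ p xs → x ∈ xs × T (p x)
∈-filterᵇ⁻ p {xs = xs} x∈ rewrite filterᵇ≡List-filterᵇ p xs = ∈-filter⁻ (T? ∘ p) x∈

filterᵇ-unique : ∀ {A : Set} (p : A → Bool) {xs} → Unique xs → Unique (filterᵇ p xs)
filterᵇ-unique p {xs} xs! rewrite filterᵇ≡List-filterᵇ p xs = Unique.filter⁺ (T? ∘ p) xs!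

private
  all≡ListAction-all : ∀ {A : Set} (p : A → Bool) xs → all p xs ≡ ListAction.all p xs
  all≡ListAction-all p []       = refl
  all≡ListAction-all p (x ∷ xs) = cong (p x ∧_) (all≡ListAction-all p xs)

T-all-allFin : ∀ {n} (p : Fin n → Bool) → T (all p (allFin n)) ⇔ (∀ i → T (p i))
T-all-allFin {n} p rewrite all≡ListAction-all p (allFin n) =
  mk⇔ (All.tabulate⁻ ∘ All.all⁺ p (allFin n)) (All.all⁻ p ∘ All.tabulate⁺)

T-not-∨ : ∀ {x y} → T (not x ∨ y) ⇔ (T x → T y)
T-not-∨ {false} = mk⇔ (λ _ ()) (λ _ → tt)
T-not-∨ {true}  = mk⇔ (λ y _ → y) (λ x⇒y → x⇒y tt)

IsLowerIdeal : (P : FinPoset) → Subset (size P) → Set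
IsLowerIdeal P S = ∀ a b → T (leq P a b) → T (lookup S b) → T (lookup S a)

Included : ∀ {n} → Subset n → Subset n → Set
Included S S′ = ∀ p → T (lookup S p) → T (lookup S′ p)

IsMonotone : (R : FinPoset) → Vec ℕ (size R) → Set
IsMonotone R z = ∀ p p′ → T (leq R p p′) → lookup z p ≤ lookup z p′

T-isLowerIdeal : ∀ P S → T (isLowerIdeal P S) ⇔ IsLowerIdeal P S
T-isLowerIdeal P S = mk⇔
  (λ h a b a≤b b∈S →
     to T-not-∨ (to (T-all-allFin _) (to (T-all-allFin _) h b) a) (from T-∧ (a≤b , b∈S)))
  (λ h → from (T-all-allFin _) λ b → from (T-all-allFin _) λ a →
     from T-not-∨ λ a≤b∧b∈S → let a≤b , b∈S = to T-∧ a≤b∧b∈S in h a b a≤b b∈S)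

T-inclusion : ∀ {n} (S S′ : Subset n) → T (inclusion S S′) ⇔ Included S S′
T-inclusion S S′ = mk⇔
  (λ h p → to T-not-∨ (to (T-all-allFin _) h p))
  (λ h → from (T-all-allFin _) λ p → from T-not-∨ (h p))

T-isMonotone : ∀ R z → T (isMonotone R z) ⇔ IsMonotone R z
T-isMonotone R z = mk⇔
  (λ h p p′ p≤p′ →
     ℕ.≤ᵇ⇒≤ _ _ (to T-not-∨ (to (T-all-allFin _) (to (T-all-allFin _) h p) p′) p≤p′))
  (λ h → from (T-all-allFin _) λ p → from (T-all-allFin _) λ p′ →
     from T-not-∨ λ p≤p′ → ℕ.≤⇒≤ᵇ (h p p′ p≤p′))

T-weaklyIncr : ∀ {A : Set} (le : A → A → Bool) xs → T (weaklyIncr le xs) ⇔ Linked (λ x y → T (le x y)) xs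
T-weaklyIncr le xs = mk⇔ (to′ xs) from′
  where
  to′ : ∀ xs → T (weaklyIncr le xs) → Linked (λ x y → T (le x y)) xs
  to′ []           _ = []
  to′ (x ∷ [])     _ = [-]
  to′ (x ∷ y ∷ xs) h = let x≤y , rest = to T-∧ h in x≤y ∷ to′ (y ∷ xs) rest
  from′ : ∀ {xs} → Linked (λ x y → T (le x y)) xs → T (weaklyIncr le xs)
  from′ []           = tt
  from′ [-]          = tt
  from′ (x≤y ∷ rest) = from T-∧ (x≤y , from′ rest)

concatMap-map≡cartesianProductWith : ∀ {A B C : Set} (f : A → B → C) xs ys →
  concatMap (λ x → map (f x) ys) xs ≡ cartesianProductWith f xs ys
concatMap-map≡cartesianProductWith f []       ys = refl
concatMap-map≡cartesianProductWith f (x ∷ xs) ys =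
  cong (map (f x) ys ++_) (concatMap-map≡cartesianProductWith f xs ys)

module _ {A : Set} (es : List A) where

  allSeqs-suc : ∀ m → allSeqs es (suc m) ≡ cartesianProductWith _∷_ es (allSeqs es m)
  allSeqs-suc m = concatMap-map≡cartesianProductWith _∷_ es (allSeqs es m)

  ∈-allSeqs⁺ : ∀ m {s} → length s ≡ m → All (_∈ es) s → s ∈ allSeqs es m
  ∈-allSeqs⁺ zero    {[]}    refl []          = here refl
  ∈-allSeqs⁺ (suc m) {e ∷ s} len  (e∈ ∷ s∈es) rewrite allSeqs-suc m =
    ∈-cartesianProductWith⁺ _∷_ e∈ (∈-allSeqs⁺ m (ℕ.suc-injective len) s∈es)

  ∈-allSeqs⁻ : ∀ m {s} → s ∈ allSeqs es m → length s ≡ m × All (_∈ es) s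
  ∈-allSeqs⁻ zero    (here refl) = refl , []
  ∈-allSeqs⁻ (suc m) s∈ rewrite allSeqs-suc m with ∈-cartesianProductWith⁻ _∷_ es (allSeqs es m) s∈
  ... | e , s , e∈ , s∈′ , refl = let len , s∈es = ∈-allSeqs⁻ m s∈′ in cong suc len , e∈ ∷ s∈es

  allSeqs-unique : Unique es → ∀ m → Unique (allSeqs es m)
  allSeqs-unique es! zero    = [] ∷ []
  allSeqs-unique es! (suc m) rewrite allSeqs-suc m =
    Unique.cartesianProductWith⁺ _∷_ List.∷-injective es! (allSeqs-unique es! m)

vectorsOver : {A : Set} → List A → ∀ k → List (Vec A k)
vectorsOver es zero    = [] ∷ []
vectorsOver es (suc k) = cartesianProductWith _∷_ es (vectorsOver es k)

module _ {A : Set} {es : List A} where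

  ∈-vectorsOver⁺ : ∀ {k} {z : Vec A k} → (∀ i → lookup z i ∈ es) → z ∈ vectorsOver es k
  ∈-vectorsOver⁺ {z = []}    z∈es = here refl
  ∈-vectorsOver⁺ {z = x ∷ z} z∈es =
    ∈-cartesianProductWith⁺ _∷_ (z∈es zero) (∈-vectorsOver⁺ (z∈es ∘ suc))

  ∈-vectorsOver⁻ : ∀ {k} {z : Vec A k} → z ∈ vectorsOver es k → ∀ i → lookup z i ∈ es
  ∈-vectorsOver⁻ {suc k} z∈ i with ∈-cartesianProductWith⁻ _∷_ es (vectorsOver es k) z∈
  ∈-vectorsOver⁻ {suc k} z∈ zero    | x , z , x∈ , z∈′ , refl = x∈
  ∈-vectorsOver⁻ {suc k} z∈ (suc i) | x , z , x∈ , z∈′ , refl = ∈-vectorsOver⁻ z∈′ i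

  vectorsOver-unique : Unique es → ∀ k → Unique (vectorsOver es k)
  vectorsOver-unique es! zero    = [] ∷ []
  vectorsOver-unique es! (suc k) = Unique.cartesianProductWith⁺ _∷_ Vec.∷-injective es! (vectorsOver-unique es! k)

allVecsUpTo≡vectorsOver : ∀ n k → allVecsUpTo n k ≡ vectorsOver (upTo (suc n)) k
allVecsUpTo≡vectorsOver n zero    = refl
allVecsUpTo≡vectorsOver n (suc k) rewrite allVecsUpTo≡vectorsOver n k =
  concatMap-map≡cartesianProductWith _∷_ (upTo (suc n)) (vectorsOver (upTo (suc n)) k)

allSubsets≡vectorsOver : ∀ k → allSubsets k ≡ vectorsOver (true ∷ false ∷ []) k
allSubsets≡vectorsOver zero    = refl
allSubsets≡vectorsOver (suc k) rewrite allSubsets≡vectorsOver k =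
  concatMap-map≡cartesianProductWith _∷_ (true ∷ false ∷ []) (vectorsOver (true ∷ false ∷ []) k)

countTrue : List Bool → ℕ
countTrue []           = 0
countTrue (true ∷ bs)  = suc (countTrue bs)
countTrue (false ∷ bs) = countTrue bs

countTrue≤length : ∀ bs → countTrue bs ≤ length bs
countTrue≤length []           = z≤n
countTrue≤length (true ∷ bs)  = s≤s (countTrue≤length bs)
countTrue≤length (false ∷ bs) = ℕ.m≤n⇒m≤1+n (countTrue≤length bs)

step : ℕ → ℕ → List Bool
step a b = replicate a false ++ replicate b true

countTrue-step : ∀ a b → countTrue (step a b) ≡ b
countTrue-step (suc a) b       = countTrue-step a b
countTrue-step zero    zero    = refl
countTrue-step zero    (suc b) = cong suc (countTrue-step zero b)

length-step : ∀ a b → length (step a b) ≡ a ℕ.+ b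
length-step a b = trans (List.length-++ (replicate a false))
                        (cong₂ ℕ._+_ (List.length-replicate a) (List.length-replicate b))

Rising : List Bool → Set
Rising = Linked (λ x y → T x → T y)

rising⇒step : ∀ {bs} → Rising bs → ∃₂ λ a b → bs ≡ step a b
rising⇒step []                  = 0 , 0 , refl
rising⇒step ([-] {x = false})    = 1 , 0 , refl
rising⇒step ([-] {x = true})     = 0 , 1 , refl
rising⇒step (_∷_ {x = false} _ r) with rising⇒step r
... | a , b , eq = suc a , b , cong (false ∷_) eq
rising⇒step (_∷_ {x = true} x⇒y r) with rising⇒step r
... | zero  , b , eq   = 0 , suc b , cong (true ∷_) eq
... | suc a , b , refl = ⊥-elim (x⇒y tt)

thresholds : ℕ → ℕ → List Bool
thresholds v n = map (_<ᵇ v) (downFrom n)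

private
  <⇒<ᵇ≡true : ∀ {m n} → m < n → (m <ᵇ n) ≡ true
  <⇒<ᵇ≡true m<n = to T-≡ (ℕ.<⇒<ᵇ m<n)

  ≮⇒<ᵇ≡false : ∀ {m n} → ¬ m < n → (m <ᵇ n) ≡ false
  ≮⇒<ᵇ≡false {m} {n} m≮n with m <ᵇ n in eq
  ... | false = refl
  ... | true  = contradiction (ℕ.<ᵇ⇒< m n (subst T (sym eq) tt)) m≮n

thresholds-≥ : ∀ {v} n → n ≤ v → thresholds v n ≡ replicate n true
thresholds-≥ zero    _   = refl
thresholds-≥ (suc n) n<v = cong₂ _∷_ (<⇒<ᵇ≡true n<v) (thresholds-≥ n (ℕ.<⇒≤ n<v))

thresholds-step : ∀ a b → thresholds b (a ℕ.+ b) ≡ step a b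
thresholds-step zero    b = thresholds-≥ b ℕ.≤-refl
thresholds-step (suc a) b = cong₂ _∷_ (≮⇒<ᵇ≡false (ℕ.m+n≮n a b)) (thresholds-step a b)

countTrue-thresholds : ∀ {v n} → v ≤ n → countTrue (thresholds v n) ≡ v
countTrue-thresholds {v} {n} v≤n = begin
  countTrue (thresholds v n)             ≡⟨ cong (countTrue ∘ thresholds v) (ℕ.m∸n+n≡m v≤n) ⟨
  countTrue (thresholds v (n ∸ v ℕ.+ v))   ≡⟨ cong countTrue (thresholds-step (n ∸ v) v) ⟩
  countTrue (step (n ∸ v) v)             ≡⟨ countTrue-step (n ∸ v) v ⟩
  v                                      ∎
  where open ≡-Reasoning

thresholds-countTrue : ∀ {bs} → Rising bs → thresholds (countTrue bs) (length bs) ≡ bs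
thresholds-countTrue r with rising⇒step r
... | a , b , refl rewrite countTrue-step a b | length-step a b = thresholds-step a b

module _ {k : ℕ} where

  column : Fin k → List (Subset k) → List Bool
  column p = map (λ S → lookup S p)

  heights : List (Subset k) → Vec ℕ k
  heights s = tabulate (λ p → countTrue (column p s))

  level : Vec ℕ k → ℕ → Subset k
  level z j = tabulate (λ p → j <ᵇ lookup z p)

  levels : ℕ → Vec ℕ k → List (Subset k)
  levels n z = map (level z) (downFrom n)

  length-levels : ∀ n z → length (levels n z) ≡ n
  length-levels n z = trans (List.length-map (level z) (downFrom n)) (List.length-downFrom n)

  lookup-heights : ∀ s p → lookup (heights s) p ≡ countTrue (column p s)
  lookup-heights s p = Vec.lookup∘tabulate (λ p → countTrue (column p s)) p

  lookup-level : ∀ z j p → lookup (level z j) p ≡ (j <ᵇ lookup z p)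
  lookup-level z j p = Vec.lookup∘tabulate (λ p → j <ᵇ lookup z p) p

  heights≤length : ∀ s p → lookup (heights s) p ≤ length s
  heights≤length s p = begin
    lookup (heights s) p     ≡⟨ lookup-heights s p ⟩
    countTrue (column p s)   ≤⟨ countTrue≤length (column p s) ⟩
    length (column p s)      ≡⟨ List.length-map _ s ⟩
    length s                 ∎
    where open ℕ.≤-Reasoning

  column-levels : ∀ n z p → column p (levels n z) ≡ thresholds (lookup z p) n
  column-levels n z p = begin
    map (λ S → lookup S p) (map (level z) (downFrom n))
      ≡⟨ List.map-∘ (downFrom n) ⟨
    map (λ j → lookup (level z j) p) (downFrom n)
      ≡⟨ List.map-cong (λ j → lookup-level z j p) (downFrom n) ⟩
    thresholds (lookup z p) n
      ∎
    where open ≡-Reasoning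

  columns-injective : ∀ {s s′} → length s ≡ length s′ → (∀ p → column p s ≡ column p s′) → s ≡ s′
  columns-injective {[]}    {[]}     _   _   = refl
  columns-injective {S ∷ s} {S′ ∷ s′} len col =
    cong₂ _∷_ S≡S′ (columns-injective (ℕ.suc-injective len) (List.∷-injectiveʳ ∘ col))
    where
    S≡S′ : S ≡ S′
    S≡S′ = begin
      S                     ≡⟨ Vec.tabulate∘lookup S ⟨
      tabulate (lookup S)   ≡⟨ Vec.tabulate-cong (List.∷-injectiveˡ ∘ col) ⟩
      tabulate (lookup S′)  ≡⟨ Vec.tabulate∘lookup S′ ⟩
      S′                    ∎
      where open ≡-Reasoning

  heights-levels : ∀ n z → (∀ p → lookup z p ≤ n) → heights (levels n z) ≡ z
  heights-levels n z bounded = trans (Vec.tabulate-cong λ p → begin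
      countTrue (column p (levels n z))   ≡⟨ cong countTrue (column-levels n z p) ⟩
      countTrue (thresholds (lookup z p) n) ≡⟨ countTrue-thresholds (bounded p) ⟩
      lookup z p                           ∎)
    (Vec.tabulate∘lookup z)
    where open ≡-Reasoning

  -- The columns of a chain S₁ ⊆ ⋯ ⊆ Sₙ are rising, so each is recovered from its number of trues.
  levels-heights : ∀ {s} → Linked Included s → levels (length s) (heights s) ≡ s
  levels-heights {s} chain = columns-injective (length-levels (length s) (heights s)) λ p → begin
    column p (levels (length s) (heights s))
      ≡⟨ column-levels (length s) (heights s) p ⟩
    thresholds (lookup (heights s) p) (length s)
      ≡⟨ cong₂ thresholds (lookup-heights s p) (sym (List.length-map _ s)) ⟩
    thresholds (countTrue (column p s)) (length (column p s))
      ≡⟨ thresholds-countTrue (Linked.map⁺ (Linked.map (λ S⊆S′ → S⊆S′ p) chain)) ⟩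
    column p s
      ∎
    where open ≡-Reasoning

  levels-chain : ∀ n z → Linked Included (levels n z)
  levels-chain zero          z = []
  levels-chain (suc zero)    z = [-]
  levels-chain (suc (suc n)) z = level-suc⊆level ∷ levels-chain (suc n) z
    where
    level-suc⊆level : Included (level z (suc n)) (level z n)
    level-suc⊆level p rewrite lookup-level z (suc n) p | lookup-level z n p =
      ℕ.<⇒<ᵇ ∘ ℕ.<-trans (ℕ.n<1+n n) ∘ ℕ.<ᵇ⇒< (suc n) (lookup z p)

  private
    vsum-tabulate-0 : ∀ {n} → vsum (tabulate {n = n} (λ _ → 0)) ≡ 0
    vsum-tabulate-0 {zero}  = refl
    vsum-tabulate-0 {suc n} = vsum-tabulate-0 {n}

  vsum-tabulate-countTrue-∷ : ∀ {n} (S : Subset n) (c : Fin n → List Bool) →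
    vsum (tabulate (λ p → countTrue (lookup S p ∷ c p))) ≡ ∣ S ∣ ℕ.+ vsum (tabulate (countTrue ∘ c))
  vsum-tabulate-countTrue-∷ []      c = refl
  vsum-tabulate-countTrue-∷ (b ∷ S) c = begin
    countTrue (b ∷ c zero) ℕ.+ vsum (tabulate (λ p → countTrue (lookup S p ∷ c (suc p))))
      ≡⟨ cong (countTrue (b ∷ c zero) ℕ.+_) (vsum-tabulate-countTrue-∷ S (c ∘ suc)) ⟩
    countTrue (b ∷ c zero) ℕ.+ (∣ S ∣ ℕ.+ rest)
      ≡⟨ exchange b ⟩
    ∣ b ∷ S ∣ ℕ.+ (countTrue (c zero) ℕ.+ rest)
      ∎
    where
    open ≡-Reasoning
    rest = vsum (tabulate (countTrue ∘ c ∘ suc))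
    exchange : ∀ b → countTrue (b ∷ c zero) ℕ.+ (∣ S ∣ ℕ.+ rest) ≡ ∣ b ∷ S ∣ ℕ.+ (countTrue (c zero) ℕ.+ rest)
    exchange true  = cong suc (+-left-comm (countTrue (c zero)) ∣ S ∣ rest)
    exchange false = +-left-comm (countTrue (c zero)) ∣ S ∣ rest

  -- Double counting the incidences (i, p) with p ∈ Sᵢ.
  sum-rk≡vsum-heights : ∀ s → sum (map rk s) ≡ vsum (heights s)
  sum-rk≡vsum-heights []      = sym (vsum-tabulate-0 {k})
  sum-rk≡vsum-heights (S ∷ s) =
    trans (cong (rk S ℕ.+_) (sum-rk≡vsum-heights s)) (sym (vsum-tabulate-countTrue-∷ S (λ p → column p s)))

countTrue-map-mono : ∀ {A : Set} {f g : A → Bool} {xs} → All (λ x → T (f x) → T (g x)) xs →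
                     countTrue (map f xs) ≤ countTrue (map g xs)
countTrue-map-mono []                 = z≤n
countTrue-map-mono {f = f} {g} {x ∷ xs} (fx⇒gx ∷ rest) with f x | g x
... | true  | true  = s≤s (countTrue-map-mono rest)
... | true  | false = ⊥-elim (fx⇒gx tt)
... | false | true  = ℕ.m≤n⇒m≤1+n (countTrue-map-mono rest)
... | false | false = countTrue-map-mono rest

bijection⇒map-↭ : ∀ {A B : Set} (f : A → B) (g : B → A) {xs ys} → Unique xs → Unique ys →
  (∀ {x} → x ∈ xs → f x ∈ ys × g (f x) ≡ x) → (∀ {y} → y ∈ ys → g y ∈ xs × f (g y) ≡ y) →
  map f xs ↭ ys
bijection⇒map-↭ f g {xs} {ys} xs! ys! forth back = ∼bag⇒↭ (unique∧set⇒bag fxs! ys! (mk⇔ ∈ys ∈fxs))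
  where
  gfxs≡xs : map g (map f xs) ≡ xs
  gfxs≡xs = trans (sym (List.map-∘ xs)) (List.map-id-local (All.tabulate (proj₂ ∘ forth)))
  fxs! : Unique (map f xs)
  fxs! = Unique.map⁻ {f = g} (subst Unique (sym gfxs≡xs) xs!)
  ∈ys : ∀ {y} → y ∈ map f xs → y ∈ ys
  ∈ys y∈ with ∈-map⁻ f y∈
  ... | x , x∈xs , refl = proj₁ (forth x∈xs)
  ∈fxs : ∀ {y} → y ∈ ys → y ∈ map f xs
  ∈fxs y∈ = subst (_∈ map f xs) (proj₂ (back y∈)) (∈-map⁺ f (proj₁ (back y∈)))

module _ (P : FinPoset) where

  private
    n : ℕ
    n = size P

  heights-monotone : ∀ {s} → All (IsLowerIdeal P) s → IsMonotone (dual P) (heights s)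
  heights-monotone {s} ideals p p′ p′≤p rewrite lookup-heights s p | lookup-heights s p′ =
    countTrue-map-mono (All.map (λ ideal → ideal p′ p p′≤p) ideals)

  level-lowerIdeal : ∀ z → IsMonotone (dual P) z → ∀ j → IsLowerIdeal P (level z j)
  level-lowerIdeal z mono j a b a≤b rewrite lookup-level z j a | lookup-level z j b =
    ℕ.<⇒<ᵇ ∘ (λ j<zb → ℕ.<-≤-trans j<zb (mono b a a≤b)) ∘ ℕ.<ᵇ⇒< j (lookup z b)

  ∈-idealsJ⁺ : ∀ {S} → IsLowerIdeal P S → S ∈ idealsJ P
  ∈-idealsJ⁺ {S} ideal =
    ∈-filterᵇ⁺ (isLowerIdeal P)
      (subst (S ∈_) (sym (allSubsets≡vectorsOver n)) (∈-vectorsOver⁺ λ i → bool∈ (lookup S i)))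
      (from (T-isLowerIdeal P S) ideal)
    where
    bool∈ : ∀ b → b ∈ true ∷ false ∷ []
    bool∈ true  = here refl
    bool∈ false = there (here refl)

  ∈-idealsJ⁻ : ∀ {S} → S ∈ idealsJ P → IsLowerIdeal P S
  ∈-idealsJ⁻ {S} S∈ = to (T-isLowerIdeal P S) (proj₂ (∈-filterᵇ⁻ (isLowerIdeal P) {xs = allSubsets n} S∈))

  idealsJ-unique : Unique (idealsJ P)
  idealsJ-unique = filterᵇ-unique (isLowerIdeal P)
    (subst Unique (sym (allSubsets≡vectorsOver n)) (vectorsOver-unique (((λ ()) ∷ []) ∷ [] ∷ []) n))

  chains : ℕ → List (List (Subset n))
  chains m = filterᵇ (weaklyIncr inclusion) (allSeqs (idealsJ P) m)

  monotoneMaps : ℕ → List (Vec ℕ n)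
  monotoneMaps m = filterᵇ (isMonotone (dual P)) (allVecsUpTo m n)

  T-weaklyIncr-inclusion : ∀ (s : List (Subset n)) → T (weaklyIncr inclusion s) ⇔ Linked Included s
  T-weaklyIncr-inclusion s = mk⇔
    (Linked.map (λ {S} {S′} → to (T-inclusion S S′)) ∘ to (T-weaklyIncr inclusion s))
    (from (T-weaklyIncr inclusion s) ∘ Linked.map (λ {S} {S′} → from (T-inclusion S S′)))

  ∈-chains⁺ : ∀ {m s} → length s ≡ m → All (IsLowerIdeal P) s → Linked Included s → s ∈ chains m
  ∈-chains⁺ {m} {s} len ideals chain = ∈-filterᵇ⁺ (weaklyIncr inclusion)
    (∈-allSeqs⁺ (idealsJ P) m len (All.map ∈-idealsJ⁺ ideals))
    (from (T-weaklyIncr-inclusion s) chain)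

  ∈-chains⁻ : ∀ {m s} → s ∈ chains m → length s ≡ m × All (IsLowerIdeal P) s × Linked Included s
  ∈-chains⁻ {m} {s} s∈ =
    let s∈seqs , incr = ∈-filterᵇ⁻ (weaklyIncr inclusion) {xs = allSeqs (idealsJ P) m} s∈
        len , s⊆J = ∈-allSeqs⁻ (idealsJ P) m s∈seqs
    in len , All.map ∈-idealsJ⁻ s⊆J , to (T-weaklyIncr-inclusion s) incr

  chains-unique : ∀ m → Unique (chains m)
  chains-unique m = filterᵇ-unique (weaklyIncr inclusion) (allSeqs-unique (idealsJ P) idealsJ-unique m)

  ∈-monotoneMaps⁺ : ∀ {m z} → (∀ p → lookup z p ≤ m) → IsMonotone (dual P) z → z ∈ monotoneMaps m
  ∈-monotoneMaps⁺ {m} {z} bounded mono = ∈-filterᵇ⁺ (isMonotone (dual P))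
    (subst (z ∈_) (sym (allVecsUpTo≡vectorsOver m n)) (∈-vectorsOver⁺ (∈-upTo⁺ ∘ s≤s ∘ bounded)))
    (from (T-isMonotone (dual P) z) mono)

  ∈-monotoneMaps⁻ : ∀ {m z} → z ∈ monotoneMaps m → (∀ p → lookup z p ≤ m) × IsMonotone (dual P) z
  ∈-monotoneMaps⁻ {m} {z} z∈ =
    let z∈vecs , mono = ∈-filterᵇ⁻ (isMonotone (dual P)) {xs = allVecsUpTo m n} z∈
        z∈vecs′ = subst (z ∈_) (allVecsUpTo≡vectorsOver m n) z∈vecs
    in ℕ.≤-pred ∘ ∈-upTo⁻ ∘ ∈-vectorsOver⁻ z∈vecs′ , to (T-isMonotone (dual P) z) mono

  monotoneMaps-unique : ∀ m → Unique (monotoneMaps m)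
  monotoneMaps-unique m = filterᵇ-unique (isMonotone (dual P))
    (subst Unique (sym (allVecsUpTo≡vectorsOver m n)) (vectorsOver-unique (Unique.upTo⁺ (suc m)) n))

  heights-↭ : ∀ m → map heights (chains m) ↭ monotoneMaps m
  heights-↭ m = bijection⇒map-↭ heights (levels m) (chains-unique m) (monotoneMaps-unique m) forth back
    where
    forth : ∀ {s} → s ∈ chains m → heights s ∈ monotoneMaps m × levels m (heights s) ≡ s
    forth {s} s∈ =
      let len , ideals , chain = ∈-chains⁻ s∈
      in ∈-monotoneMaps⁺ (λ p → subst (lookup (heights s) p ≤_) len (heights≤length s p))
                         (heights-monotone ideals)
       , subst (λ l → levels l (heights s) ≡ s) len (levels-heights chain)
    back : ∀ {z} → z ∈ monotoneMaps m → levels m z ∈ chains m × heights (levels m z) ≡ z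
    back {z} z∈ =
      let bounded , mono = ∈-monotoneMaps⁻ z∈
      in ∈-chains⁺ (length-levels m z)
                   (All.map⁺ (All.universal (level-lowerIdeal z mono) (downFrom m)))
                   (levels-chain m z)
       , heights-levels m z bounded

  zetaSum-idealsJ≡orderSum-dual : ∀ m → zetaSum (idealsJ P) inclusion rk m ≡ orderSum (dual P) m
  zetaSum-idealsJ≡orderSum-dual m = begin
    sumZ (map (λ s → qpow (sum (map rk s))) (chains m))
      ≡⟨ cong sumZ (List.map-cong (cong qpow ∘ sum-rk≡vsum-heights) (chains m)) ⟩
    sumZ (map (λ s → qpow (vsum (heights s))) (chains m))
      ≡⟨ cong sumZ (List.map-∘ (chains m)) ⟩
    sumZ (map (λ z → qpow (vsum z)) (map heights (chains m)))
      ≡⟨ sumZ-↭ (↭.map⁺ (λ z → qpow (vsum z)) (heights-↭ m)) ⟩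
    sumZ (map (λ z → qpow (vsum z)) (monotoneMaps m))
      ∎
    where open ≡-Reasoning

valueZ : Zq → ℤ → ℤ
valueZ []      t = 0ℤ
valueZ (a ∷ p) t = a + t * valueZ p t

valueZ-addZ : ∀ p r t → valueZ (addZ p r) t ≡ valueZ p t + valueZ r t
valueZ-addZ []      r       t = sym (ℤ.+-identityˡ _)
valueZ-addZ (a ∷ p) []      t = sym (ℤ.+-identityʳ _)
valueZ-addZ (a ∷ p) (b ∷ r) t = begin
  (a + b) + t * valueZ (addZ p r) t            ≡⟨ cong (λ v → (a + b) + t * v) (valueZ-addZ p r t) ⟩
  (a + b) + t * (valueZ p t + valueZ r t)      ≡⟨ horner-+ a b t (valueZ p t) (valueZ r t) ⟩
  (a + t * valueZ p t) + (b + t * valueZ r t)  ∎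
  where
  open ≡-Reasoning
  horner-+ : ∀ a b t u v → (a + b) + t * (u + v) ≡ (a + t * u) + (b + t * v)
  horner-+ = solve-∀

valueZ-negZ : ∀ p t → valueZ (negZ p) t ≡ - valueZ p t
valueZ-negZ []      t = refl
valueZ-negZ (a ∷ p) t = trans (cong (λ v → - a + t * v) (valueZ-negZ p t)) (horner-neg a t (valueZ p t))
  where
  horner-neg : ∀ a t v → - a + t * - v ≡ - (a + t * v)
  horner-neg = solve-∀

valueZ-scaleZ : ∀ c p t → valueZ (scaleZ c p) t ≡ c * valueZ p t
valueZ-scaleZ c []      t = sym (ℤ.*-zeroʳ c)
valueZ-scaleZ c (a ∷ p) t = trans (cong (λ v → c * a + t * v) (valueZ-scaleZ c p t)) (horner-* c a t (valueZ p t))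
  where
  horner-* : ∀ c a t v → c * a + t * (c * v) ≡ c * (a + t * v)
  horner-* = solve-∀

valueZ-mulZ : ∀ p r t → valueZ (mulZ p r) t ≡ valueZ p t * valueZ r t
valueZ-mulZ []      r t = refl
valueZ-mulZ (a ∷ p) r t = begin
  valueZ (addZ (scaleZ a r) (0ℤ ∷ mulZ p r)) t
    ≡⟨ valueZ-addZ (scaleZ a r) (0ℤ ∷ mulZ p r) t ⟩
  valueZ (scaleZ a r) t + (0ℤ + t * valueZ (mulZ p r) t)
    ≡⟨ cong₂ (λ u v → u + (0ℤ + t * v)) (valueZ-scaleZ a r t) (valueZ-mulZ p r t) ⟩
  a * valueZ r t + (0ℤ + t * (valueZ p t * valueZ r t))
    ≡⟨ horner-mul a t (valueZ p t) (valueZ r t) ⟩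
  (a + t * valueZ p t) * valueZ r t
    ∎
  where
  open ≡-Reasoning
  horner-mul : ∀ a t u v → a * v + (0ℤ + t * (u * v)) ≡ (a + t * u) * v
  horner-mul = solve-∀

valueZ-IsZeroZ : ∀ {p} t → IsZeroZ p → valueZ p t ≡ 0ℤ
valueZ-IsZeroZ t []         = refl
valueZ-IsZeroZ t (refl ∷ z) =
  trans (cong (λ v → 0ℤ + t * v) (valueZ-IsZeroZ t z)) (cong (λ v → 0ℤ + v) (ℤ.*-zeroʳ t))

valueZ-≈Z : ∀ p r t → p ≈Z r → valueZ p t ≡ valueZ r t
valueZ-≈Z p r t p≈r = ℤ.i-j≡0⇒i≡j _ _ (begin
  valueZ p t - valueZ r t                ≡⟨ cong (λ v → valueZ p t + v) (valueZ-negZ r t) ⟨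
  valueZ p t + valueZ (negZ r) t         ≡⟨ valueZ-addZ p (negZ r) t ⟨
  valueZ (addZ p (negZ r)) t             ≡⟨ valueZ-IsZeroZ t p≈r ⟩
  0ℤ                                     ∎)
  where open ≡-Reasoning

valueAt : ℤ → Zq → ℤ
valueAt t p = valueZ p t

valueX : PolyX → ℤ → ℤ → ℤ
valueX p t = valueZ (map (valueAt t) p)

map-valueAt-addX : ∀ t p r → map (valueAt t) (addX p r) ≡ addZ (map (valueAt t) p) (map (valueAt t) r)
map-valueAt-addX t []      r       = refl
map-valueAt-addX t (a ∷ p) []      = refl
map-valueAt-addX t (a ∷ p) (b ∷ r) = cong₂ _∷_ (valueZ-addZ a b t) (map-valueAt-addX t p r)

map-valueAt-negX : ∀ t p → map (valueAt t) (negX p) ≡ negZ (map (valueAt t) p)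
map-valueAt-negX t []      = refl
map-valueAt-negX t (a ∷ p) = cong₂ _∷_ (valueZ-negZ a t) (map-valueAt-negX t p)

map-valueAt-scaleX : ∀ t c p → map (valueAt t) (map (mulZ c) p) ≡ scaleZ (valueZ c t) (map (valueAt t) p)
map-valueAt-scaleX t c []      = refl
map-valueAt-scaleX t c (a ∷ p) = cong₂ _∷_ (valueZ-mulZ c a t) (map-valueAt-scaleX t c p)

map-valueAt-mulX : ∀ t p r → map (valueAt t) (mulX p r) ≡ mulZ (map (valueAt t) p) (map (valueAt t) r)
map-valueAt-mulX t []      r = refl
map-valueAt-mulX t (c ∷ p) r = begin
  map (valueAt t) (addX (map (mulZ c) r) ([] ∷ mulX p r))
    ≡⟨ map-valueAt-addX t (map (mulZ c) r) ([] ∷ mulX p r) ⟩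
  addZ (map (valueAt t) (map (mulZ c) r)) (0ℤ ∷ map (valueAt t) (mulX p r))
    ≡⟨ cong₂ (λ u v → addZ u (0ℤ ∷ v)) (map-valueAt-scaleX t c r) (map-valueAt-mulX t p r) ⟩
  addZ (scaleZ (valueZ c t) (map (valueAt t) r)) (0ℤ ∷ mulZ (map (valueAt t) p) (map (valueAt t) r))
    ∎
  where open ≡-Reasoning

valueX-addX : ∀ p r t x → valueX (addX p r) t x ≡ valueX p t x + valueX r t x
valueX-addX p r t x =
  trans (cong (λ u → valueZ u x) (map-valueAt-addX t p r)) (valueZ-addZ (map (valueAt t) p) (map (valueAt t) r) x)

valueX-negX : ∀ p t x → valueX (negX p) t x ≡ - valueX p t x
valueX-negX p t x =
  trans (cong (λ u → valueZ u x) (map-valueAt-negX t p)) (valueZ-negZ (map (valueAt t) p) x)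

valueX-scaleX : ∀ c p t x → valueX (map (mulZ c) p) t x ≡ valueZ c t * valueX p t x
valueX-scaleX c p t x =
  trans (cong (λ u → valueZ u x) (map-valueAt-scaleX t c p)) (valueZ-scaleZ (valueZ c t) (map (valueAt t) p) x)

valueX-mulX : ∀ p r t x → valueX (mulX p r) t x ≡ valueX p t x * valueX r t x
valueX-mulX p r t x =
  trans (cong (λ u → valueZ u x) (map-valueAt-mulX t p r)) (valueZ-mulZ (map (valueAt t) p) (map (valueAt t) r) x)

valueX-compX : ∀ p r t x → valueX (compX p r) t x ≡ valueX p t (valueX r t x)
valueX-compX []      r t x = refl
valueX-compX (c ∷ p) r t x = begin
  valueX (addX (c ∷ []) (mulX r (compX p r))) t x
    ≡⟨ valueX-addX (c ∷ []) (mulX r (compX p r)) t x ⟩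
  (valueZ c t + x * 0ℤ) + valueX (mulX r (compX p r)) t x
    ≡⟨ cong₂ _+_ (cong (λ v → valueZ c t + v) (ℤ.*-zeroʳ x)) (valueX-mulX r (compX p r) t x) ⟩
  (valueZ c t + 0ℤ) + valueX r t x * valueX (compX p r) t x
    ≡⟨ cong₂ (λ u v → u + valueX r t x * v) (ℤ.+-identityʳ (valueZ c t)) (valueX-compX p r t x) ⟩
  valueZ c t + valueX r t x * valueX p t (valueX r t x)
    ∎
  where open ≡-Reasoning

valueX-onePlusQx : ∀ t x → valueX onePlusQx t x ≡ 1ℤ + t * x
valueX-onePlusQx = unfolded
  where
  unfolded : ∀ t x → (1ℤ + t * 0ℤ) + x * ((0ℤ + t * (1ℤ + t * 0ℤ)) + x * 0ℤ) ≡ 1ℤ + t * x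
  unfolded = solve-∀

valueZ-evalX : ∀ p v t → valueZ (evalX p v) t ≡ valueX p t (valueZ v t)
valueZ-evalX []      v t = refl
valueZ-evalX (c ∷ p) v t = begin
  valueZ (addZ c (mulZ v (evalX p v))) t
    ≡⟨ valueZ-addZ c (mulZ v (evalX p v)) t ⟩
  valueZ c t + valueZ (mulZ v (evalX p v)) t
    ≡⟨ cong (λ u → valueZ c t + u) (valueZ-mulZ v (evalX p v) t) ⟩
  valueZ c t + valueZ v t * valueZ (evalX p v) t
    ≡⟨ cong (λ u → valueZ c t + valueZ v t * u) (valueZ-evalX p v t) ⟩
  valueZ c t + valueZ v t * valueX p t (valueZ v t)
    ∎
  where open ≡-Reasoning

-- Coefficients of ((c ∷ p)(x) − (c ∷ p)(a)) / (x − a); they do not depend on c.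
quotient : ℤ → Zq → Zq
quotient a []      = []
quotient a (d ∷ p) = valueZ (d ∷ p) a ∷ quotient a p

length-quotient : ∀ a p → length (quotient a p) ≡ length p
length-quotient a []      = refl
length-quotient a (d ∷ p) = cong suc (length-quotient a p)

valueZ-quotient : ∀ a c p x → valueZ (c ∷ p) x ≡ valueZ (c ∷ p) a + (x - a) * valueZ (quotient a p) x
valueZ-quotient a c []      x = base c x a
  where
  base : ∀ c x a → c + x * 0ℤ ≡ (c + a * 0ℤ) + (x - a) * 0ℤ
  base = solve-∀
valueZ-quotient a c (d ∷ p) x =
  trans (cong (λ v → c + x * v) (valueZ-quotient a d p x))
        (division-step c x a (valueZ (d ∷ p) a) (valueZ (quotient a p) x))
  where
  division-step : ∀ c x a v w → c + x * (v + (x - a) * w) ≡ (c + a * v) + (x - a) * (v + x * w)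
  division-step = solve-∀

private
  c+a*v≡0⇒c≡0 : ∀ c a {v} → v ≡ 0ℤ → c + a * v ≡ 0ℤ → c ≡ 0ℤ
  c+a*v≡0⇒c≡0 c a refl eq = trans (sym (trans (cong (λ u → c + u) (ℤ.*-zeroʳ a)) (ℤ.+-identityʳ c))) eq

IsZeroZ-from-quotient : ∀ a c p → valueZ (c ∷ p) a ≡ 0ℤ → IsZeroZ (quotient a p) → IsZeroZ (c ∷ p)
IsZeroZ-from-quotient a c []      eq []        = c+a*v≡0⇒c≡0 c a refl eq ∷ []
IsZeroZ-from-quotient a c (d ∷ p) eq (v≡0 ∷ z) = c+a*v≡0⇒c≡0 c a v≡0 eq ∷ IsZeroZ-from-quotient a d p v≡0 z

valueZ-vanishing⇒IsZeroZ : ∀ (f : ℕ → ℤ) → Injective _≡_ _≡_ f →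
                            ∀ p → (∀ m → valueZ p (f m) ≡ 0ℤ) → IsZeroZ p
valueZ-vanishing⇒IsZeroZ f f-inj p = go (length p) p refl f f-inj
  where
  go : ∀ n p → length p ≡ n → ∀ (f : ℕ → ℤ) → Injective _≡_ _≡_ f → (∀ m → valueZ p (f m) ≡ 0ℤ) → IsZeroZ p
  go _       []      _   _ _     _   = []
  go (suc n) (c ∷ p) len f f-inj van =
    IsZeroZ-from-quotient (f 0) c p (van 0)
      (go n (quotient (f 0) p) (trans (length-quotient (f 0) p) (ℕ.suc-injective len))
          (f ∘ suc) (ℕ.suc-injective ∘ f-inj) quotient-vanishes)
    where
    product≡0 : ∀ m → (f (suc m) - f 0) * valueZ (quotient (f 0) p) (f (suc m)) ≡ 0ℤ
    product≡0 m = begin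
      (f (suc m) - f 0) * valueZ (quotient (f 0) p) (f (suc m))
        ≡⟨ ℤ.+-identityˡ _ ⟨
      0ℤ + (f (suc m) - f 0) * valueZ (quotient (f 0) p) (f (suc m))
        ≡⟨ cong (λ u → u + _) (van 0) ⟨
      valueZ (c ∷ p) (f 0) + (f (suc m) - f 0) * _
        ≡⟨ valueZ-quotient (f 0) c p (f (suc m)) ⟨
      valueZ (c ∷ p) (f (suc m))
        ≡⟨ van (suc m) ⟩
      0ℤ
        ∎
      where open ≡-Reasoning
    -- At x = f (suc m) the factor x − f 0 is nonzero, by injectivity.
    quotient-vanishes : ∀ m → valueZ (quotient (f 0) p) (f (suc m)) ≡ 0ℤ
    quotient-vanishes m = [ (λ x-a≡0 → contradiction (f-inj (ℤ.i-j≡0⇒i≡j _ _ x-a≡0)) λ ()) , id ]′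
                            (ℤ.i*j≡0⇒i≡0∨j≡0 (f (suc m) - f 0) (product≡0 m))

valueX-vanishing⇒All-IsZeroZ : ∀ (f : ℕ → ℤ) (g : ℕ → ℕ → ℤ) →
                               Injective _≡_ _≡_ f → (∀ s → Injective _≡_ _≡_ (g s)) →
                               ∀ D → (∀ s m → valueX D (f s) (g s m) ≡ 0ℤ) → All IsZeroZ D
valueX-vanishing⇒All-IsZeroZ f g f-inj g-inj D van =
  All.tabulate λ {c} c∈D → valueZ-vanishing⇒IsZeroZ f f-inj c λ s →
    All.lookup (All.map⁻ (valueZ-vanishing⇒IsZeroZ (g s) (g-inj s) (map (valueAt (f s)) D) (van s))) c∈D

repunit : ℕ → ℕ → ℕ
repunit t zero    = 0
repunit t (suc n) = suc (t ℕ.* repunit t n)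

valueZ-qint : ∀ t n → valueZ (qint n) (ℤ.+ t) ≡ ℤ.+ repunit t n
valueZ-qint t zero    = refl
valueZ-qint t (suc n) = begin
  1ℤ + ℤ.+ t * valueZ (qint n) (ℤ.+ t)  ≡⟨ cong (λ v → 1ℤ + ℤ.+ t * v) (valueZ-qint t n) ⟩
  1ℤ + ℤ.+ t * ℤ.+ repunit t n          ≡⟨ cong (λ v → 1ℤ + v) (ℤ.pos-* t (repunit t n)) ⟨
  ℤ.+ suc (t ℕ.* repunit t n)           ∎
  where open ≡-Reasoning

<-step⇒<-mono : ∀ (f : ℕ → ℕ) → (∀ n → f n < f (suc n)) → ∀ {m n} → m < n → f m < f n
<-step⇒<-mono f inc {m} {suc n} (s≤s m≤n) with ℕ.m≤n⇒m<n∨m≡n m≤n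
... | inj₁ m<n  = ℕ.<-trans (<-step⇒<-mono f inc m<n) (inc n)
... | inj₂ refl = inc m

<-step⇒injective : ∀ (f : ℕ → ℕ) → (∀ n → f n < f (suc n)) → Injective _≡_ _≡_ f
<-step⇒injective f inc {m} {n} fm≡fn with ℕ.<-cmp m n
... | tri< m<n _ _ = contradiction fm≡fn (ℕ.<⇒≢ (<-step⇒<-mono f inc m<n))
... | tri≈ _ m≡n _ = m≡n
... | tri> _ _ n<m = contradiction (sym fm≡fn) (ℕ.<⇒≢ (<-step⇒<-mono f inc n<m))

repunit-injective : ∀ s → Injective _≡_ _≡_ (repunit (suc s))
repunit-injective s = <-step⇒injective (repunit (suc s)) λ n → s≤s (ℕ.m≤m+n (repunit (suc s) n) _)

valueX-EvalsTo : ∀ F n {S} t → EvalsTo F n S →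
                 valueX (num F) t (valueZ (qint n) t) ≡ valueZ (den F) t * valueZ S t
valueX-EvalsTo F n {S} t F[n]≈S = begin
  valueX (num F) t (valueZ (qint n) t)   ≡⟨ valueZ-evalX (num F) (qint n) t ⟨
  valueZ (evalX (num F) (qint n)) t      ≡⟨ valueZ-≈Z (evalX (num F) (qint n)) (mulZ (den F) S) t F[n]≈S ⟩
  valueZ (mulZ (den F) S) t              ≡⟨ valueZ-mulZ (den F) S t ⟩
  valueZ (den F) t * valueZ S t          ∎
  where open ≡-Reasoning

∘1+qx≈-intro : ∀ F G →
  (∀ s m → let t = ℤ.+ suc s; x = valueZ (qint (suc m)) t in
           valueZ (den G) t * valueX (num F) t (1ℤ + t * x) ≡ valueZ (den F) t * valueX (num G) t x) →
  F ∘1+qx≈ G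
∘1+qx≈-intro F G agree = valueX-vanishing⇒All-IsZeroZ (ℤ.+_ ∘ suc) x-values
  (ℕ.suc-injective ∘ ℤ.+-injective) x-values-injective difference vanishes
  where
  x-values : ℕ → ℕ → ℤ
  x-values s m = valueZ (qint (suc m)) (ℤ.+ suc s)
  x-values-injective : ∀ s → Injective _≡_ _≡_ (x-values s)
  x-values-injective s {m} {m′} eq = ℕ.suc-injective (repunit-injective s (ℤ.+-injective
    (trans (sym (valueZ-qint (suc s) (suc m))) (trans eq (valueZ-qint (suc s) (suc m′))))))
  lhs rhs difference : PolyX
  lhs = map (mulZ (den G)) (compX (num F) onePlusQx)
  rhs = map (mulZ (den F)) (num G)
  difference = addX lhs (negX rhs)
  vanishes : ∀ s m → valueX difference (ℤ.+ suc s) (x-values s m) ≡ 0ℤ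
  vanishes s m = begin
    valueX difference t x
      ≡⟨ valueX-addX lhs (negX rhs) t x ⟩
    valueX lhs t x + valueX (negX rhs) t x
      ≡⟨ cong₂ _+_ (valueX-scaleX (den G) (compX (num F) onePlusQx) t x) (valueX-negX rhs t x) ⟩
    valueZ (den G) t * valueX (compX (num F) onePlusQx) t x - valueX rhs t x
      ≡⟨ cong₂ (λ u v → valueZ (den G) t * u - v)
           (trans (valueX-compX (num F) onePlusQx t x) (cong (valueX (num F) t) (valueX-onePlusQx t x)))
           (valueX-scaleX (den F) (num G) t x) ⟩
    valueZ (den G) t * valueX (num F) t (1ℤ + t * x) - valueZ (den F) t * valueX (num G) t x
      ≡⟨ cong (λ u → u - valueZ (den F) t * valueX (num G) t x) (agree s m) ⟩
    valueZ (den F) t * valueX (num G) t x - valueZ (den F) t * valueX (num G) t x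
      ≡⟨ ℤ.+-inverseʳ (valueZ (den F) t * valueX (num G) t x) ⟩
    0ℤ
      ∎
    where
    open ≡-Reasoning
    t = ℤ.+ suc s
    x = x-values s m

mainTheorem3 : (P : FinPoset) (Z L : QPoly)
    → IsQZetaPoly (idealsJ P) inclusion rk Z
    → IsQOrderPoly (dual P) L
    → Z ∘1+qx≈ L
mainTheorem3 P Z L zeta order = ∘1+qx≈-intro Z L λ s m →
  let t = ℤ.+ suc s
      x = valueZ (qint (suc m)) t
      dZ = valueZ (den Z) t
      dL = valueZ (den L) t
  in begin
    dL * valueX (num Z) t (1ℤ + t * x)
      ≡⟨ cong (dL *_) (valueX-EvalsTo Z (suc (suc m)) t (zeta (suc (suc m)) (s≤s (s≤s z≤n)))) ⟩
    dL * (dZ * valueZ (zetaSum (idealsJ P) inclusion rk (suc m)) t)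
      ≡⟨ cong (λ S → dL * (dZ * valueZ S t)) (zetaSum-idealsJ≡orderSum-dual P (suc m)) ⟩
    dL * (dZ * valueZ (orderSum (dual P) (suc m)) t)
      ≡⟨ *-left-comm dL dZ _ ⟩
    dZ * (dL * valueZ (orderSum (dual P) (suc m)) t)
      ≡⟨ cong (dZ *_) (valueX-EvalsTo L (suc m) t (order (suc m))) ⟨
    dZ * valueX (num L) t x
      ∎
  where open ≡-Reasoning
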